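{- Let $n\ge3$ and let $G$ be a finite simple graph with vertex set $[1,n]$ and no isolated vertices. Let $G+\{0\}$ be the graph obtained from $G$ by adding a new vertex $0$ adjacent to every vertex of $G$. Then $\max\{t(1,n)+1,\ t(G)\}\le t(G+\{0\})\le t(G)+1$.
   Context: For a finite simple graph $H$, a $H$-CFF$(t,|V(H)|)$ is a family of subsets $B_v\subseteq[1,t]=\{1,\dots,t\}$, one for each vertex $v$, such that for every edge $\{a,b\}$: (i) $B_a\not\subseteq B_b$ and $B_b\not\subseteq B_a$, and (ii) for every vertex $w\notin\{a,b\}$, $B_w\not\subseteq B_a\cup B_b$. $t(H)$ is the minimum $t$ for which an $H$-CFF$(t,|V(H)|)$ exists. $t(1,n)$ is the minimum $t$ such that there exist $n$ subsets of $[1,t]$ none contained in another; equivalently $t(1,n)=\min\{t:\binom{t}{\lfloor t/2\rfloor}\ge n\}$. -}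

module Defs where

open import Level using (0ℓ)
open import Data.Nat using (ℕ; suc; _≤_; _<_)
open import Data.Fin using (Fin; zero; suc)
open import Data.Fin.Subset using (Subset; _⊆_; _∪_)
open import Data.Product using (_×_; ∃)
open import Data.Empty using (⊥)
open import Data.Unit using (⊤)
open import Relation.Nullary using (¬_)
open import Relation.Binary.PropositionalEquality using (_≡_; _≢_)

record Graph (n : ℕ) : Set₁ where
  field
    Adj    : Fin n → Fin n → Set
    sym    : ∀ {a b} → Adj a b → Adj b a
    irrefl : ∀ {a} → ¬ Adj a a
open Graph public

NoIsolated : ∀ {n} → Graph n → Set
NoIsolated {n} G = (v : Fin n) → ∃ λ u → Adj G v u

-- G + {0}: new vertex 'zero' adjacent to every old vertex 'suc i'.
ConeAdj : ∀ {n} → Graph n → Fin (suc n) → Fin (suc n) → Set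
ConeAdj G zero    zero    = ⊥
ConeAdj G zero    (suc j) = ⊤
ConeAdj G (suc i) zero    = ⊤
ConeAdj G (suc i) (suc j) = Adj G i j

coneSym : ∀ {n} (G : Graph n) {a b : Fin (suc n)} → ConeAdj G a b → ConeAdj G b a
coneSym G {zero}  {zero}  ()
coneSym G {zero}  {suc j} p = p
coneSym G {suc i} {zero}  p = p
coneSym G {suc i} {suc j} p = sym G p

coneIrrefl : ∀ {n} (G : Graph n) {a : Fin (suc n)} → ¬ ConeAdj G a a
coneIrrefl G {zero}  ()
coneIrrefl G {suc i} p = irrefl G p

cone : ∀ {n} → Graph n → Graph (suc n)
cone G = record { Adj = ConeAdj G ; sym = λ {a} {b} → coneSym G {a} {b} ; irrefl = λ {a} → coneIrrefl G {a} }

IsCFF : ∀ {n} → Graph n → (t : ℕ) → (Fin n → Subset t) → Set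
IsCFF {n} H t B =
  ∀ a b → Adj H a b →
    ¬ (B a ⊆ B b) × ¬ (B b ⊆ B a) ×
    ((w : Fin n) → w ≢ a → w ≢ b → ¬ (B w ⊆ B a ∪ B b))

HasCFF : ∀ {n} → Graph n → ℕ → Set
HasCFF {n} H t = ∃ λ (B : Fin n → Subset t) → IsCFF H t B

IsTH : ∀ {n} → Graph n → ℕ → Set
IsTH H m = HasCFF H m × (∀ t → t < m → ¬ HasCFF H t)

HasAntichain : ℕ → ℕ → Set
HasAntichain n t =
  ∃ λ (B : Fin n → Subset t) → ∀ i j → i ≢ j → ¬ (B i ⊆ B j)

IsT1 : ℕ → ℕ → Set
IsT1 n m = HasAntichain n m × (∀ t → t < m → ¬ HasAntichain n t)

-- A cone CFF restricts to a G-CFF, which gives t(G) ≤ t(G+{0}).  Conversely, a G-CFF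
-- extends to the cone by one new point: the apex gets {new point} and every other vertex
-- keeps its block; since G has no isolated vertices its blocks are non-empty and form an
-- antichain, which is all the new edges need.  Finally, in a cone CFF the apex block B₀
-- contains some point x (it is not inside B₁), and the sets Bᵢ ∖ B₀ with the coordinate x
-- deleted form an antichain of n subsets of t(G+{0}) − 1 points: were Bᵢ ∖ B₀ ⊆ Bⱼ ∖ B₀,
-- then Bᵢ ⊆ B₀ ∪ Bⱼ, which the edge {0, j} forbids.
module Submission where

open import Defs
open import Data.Nat using (ℕ; suc; _≤_; _⊔_; _+_; _<_; s≤s)
open import Data.Product using (_×_; _,_; proj₁; proj₂)
open import Data.Nat.Properties using (≮⇒≥; ⊔-lub; +-comm)
open import Data.Fin using (Fin; zero; suc; punchOut)
open import Data.Fin.Properties using (suc-injective; _≟_)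
open import Data.Fin.Subset
  using (Subset; _⊆_; _∪_; _─_; _∈_; _∉_; Nonempty; inside; outside; ⊥)
open import Data.Fin.Subset.Properties
  using (_∈?_; nonempty?; Empty-unique; ⊆-min; drop-∷-⊆; ∉⊥; x∈p∪q⁺; p⊆p∪q; ∪-comm; ∪-identityˡ)
open import Data.Vec using (_∷_; removeAt; here; there)
open import Data.Vec.Properties using (removeAt-punchOut; []=⇒lookup; lookup⇒[]=)
open import Data.Sum using (inj₁; inj₂)
open import Data.Unit using (tt)
open import Data.Empty using (⊥-elim)
open import Function using (_∘_)
open import Relation.Nullary using (¬_; yes; no; contradiction)
open import Relation.Binary.PropositionalEquality using (_≢_; refl; trans; subst; cong) renaming (sym to ≡-sym)

least-≤ : {P : ℕ → Set} {m k : ℕ} → (∀ t → t < m → ¬ P t) → P k → m ≤ k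
least-≤ {k = k} below-m pk = ≮⇒≥ (λ k<m → below-m k k<m pk)

⊈⇒Nonempty : ∀ {t} {p q : Subset t} → ¬ (p ⊆ q) → Nonempty p
⊈⇒Nonempty {p = p} {q} p⊈q with nonempty? p
... | yes ne = ne
... | no empty = ⊥-elim (p⊈q (subst (_⊆ q) (≡-sym (Empty-unique empty)) (⊆-min q)))

x∈p─q⁺ : ∀ {t} {x : Fin t} {p q : Subset t} → x ∈ p → x ∉ q → x ∈ p ─ q
x∈p─q⁺ {q = outside ∷ _} here        _   = here
x∈p─q⁺ {q = inside  ∷ _} here        x∉q = contradiction here x∉q
x∈p─q⁺ {q = _       ∷ _} (there x∈p) x∉q = there (x∈p─q⁺ x∈p (x∉q ∘ there))

x∈p─q⁻ : ∀ {t} {x : Fin t} (p q : Subset t) → x ∈ p ─ q → x ∈ p × x ∉ q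
x∈p─q⁻            (inside  ∷ p) (outside ∷ q) here = here , λ ()
x∈p─q⁻ {x = zero} (inside  ∷ p) (inside  ∷ q) ()
x∈p─q⁻ {x = zero} (outside ∷ p) (inside  ∷ q) ()
x∈p─q⁻ {x = zero} (outside ∷ p) (outside ∷ q) ()
x∈p─q⁻            (_       ∷ p) (_       ∷ q) (there x∈p─q) with x∈p─q⁻ p q x∈p─q
... | x∈p , x∉q = there x∈p , λ { (there x∈q) → x∉q x∈q }

p─r⊆q─r⇒p⊆r∪q : ∀ {t} {p q r : Subset t} → p ─ r ⊆ q ─ r → p ⊆ r ∪ q
p─r⊆q─r⇒p⊆r∪q {q = q} {r = r} sub {y} y∈p with y ∈? r
... | yes y∈r = x∈p∪q⁺ (inj₁ y∈r)
... | no  y∉r = x∈p∪q⁺ (inj₂ (proj₁ (x∈p─q⁻ q r (sub (x∈p─q⁺ y∈p y∉r)))))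

removeAt-reflects-⊆ : ∀ {t} {x : Fin (suc t)} {p q : Subset (suc t)} →
  x ∉ p → removeAt p x ⊆ removeAt q x → p ⊆ q
removeAt-reflects-⊆ {x = x} {p} {q} x∉p sub {y} y∈p =
  lookup⇒[]= y q (trans (≡-sym (removeAt-punchOut q x≢y)) ([]=⇒lookup (sub y′∈p′)))
  where
  x≢y : x ≢ y
  x≢y refl = x∉p y∈p
  y′∈p′ : punchOut x≢y ∈ removeAt p x
  y′∈p′ = lookup⇒[]= _ _ (trans (removeAt-punchOut p x≢y) ([]=⇒lookup y∈p))

Separated : ∀ {n t} → (Fin n → Subset t) → Fin n → Fin n → Set
Separated {n} B a b =
  ¬ (B a ⊆ B b) × ¬ (B b ⊆ B a) ×
  ((w : Fin n) → w ≢ a → w ≢ b → ¬ (B w ⊆ B a ∪ B b))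

Separated-sym : ∀ {n t} {B : Fin n → Subset t} {a b} → Separated B a b → Separated B b a
Separated-sym {B = B} {a} {b} (a⊈b , b⊈a , outside-a∪b) =
  b⊈a , a⊈b , λ w w≢b w≢a → outside-a∪b w w≢a w≢b ∘ subst (B w ⊆_) (∪-comm (B b) (B a))

zero∉outside∷ : ∀ {t} {p : Subset t} → zero ∉ outside ∷ p
zero∉outside∷ ()

coneFamily : ∀ {n t} → (Fin n → Subset t) → Fin (suc n) → Subset (suc t)
coneFamily B zero    = inside ∷ ⊥
coneFamily B (suc i) = outside ∷ B i

module _ {n t : ℕ} {G : Graph n} {B : Fin n → Subset t} (noIsolated : NoIsolated G) (cff : IsCFF G t B) where

  CFF-nonempty : ∀ i → Nonempty (B i)
  CFF-nonempty i with noIsolated i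
  ... | u , i~u = ⊈⇒Nonempty (proj₁ (cff i u i~u))

  CFF-antichain : ∀ i j → i ≢ j → ¬ (B i ⊆ B j)
  CFF-antichain i j i≢j Bi⊆Bj with noIsolated j
  ... | u , j~u with u ≟ i
  ... | yes refl = proj₁ (proj₂ (cff j u j~u)) Bi⊆Bj
  ... | no  u≢i  = proj₂ (proj₂ (cff j u j~u)) i i≢j (u≢i ∘ ≡-sym) (p⊆p∪q (B u) ∘ Bi⊆Bj)

  apex-separated : ∀ j → Separated (coneFamily B) zero (suc j)
  apex-separated j =
    (λ sub → zero∉outside∷ (sub here)) ,
    (λ sub → ∉⊥ (drop-∷-⊆ sub (proj₂ (CFF-nonempty j)))) ,
    outside-apex∪j
    where
    outside-apex∪j : ∀ w → w ≢ zero → w ≢ suc j → ¬ (coneFamily B w ⊆ coneFamily B zero ∪ coneFamily B (suc j))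
    outside-apex∪j zero    w≢0 _   = contradiction refl w≢0
    outside-apex∪j (suc k) _   k≢j sub =
      CFF-antichain k j (k≢j ∘ cong suc) (subst (B k ⊆_) (∪-identityˡ (B j)) (drop-∷-⊆ sub))

  cone-separated : ∀ {a b} → Separated B a b → Separated (coneFamily B) (suc a) (suc b)
  cone-separated {a} {b} (a⊈b , b⊈a , outside-a∪b) =
    a⊈b ∘ drop-∷-⊆ , b⊈a ∘ drop-∷-⊆ , outside-sa∪sb
    where
    outside-sa∪sb : ∀ w → w ≢ suc a → w ≢ suc b → ¬ (coneFamily B w ⊆ coneFamily B (suc a) ∪ coneFamily B (suc b))
    outside-sa∪sb zero    _   _   sub = zero∉outside∷ (sub here)
    outside-sa∪sb (suc k) k≢a k≢b sub = outside-a∪b k (k≢a ∘ cong suc) (k≢b ∘ cong suc) (drop-∷-⊆ sub)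

  coneCFF : IsCFF (cone G) (suc t) (coneFamily B)
  coneCFF zero    zero    ()
  coneCFF zero    (suc j) _   = apex-separated j
  coneCFF (suc i) zero    _   = Separated-sym (apex-separated i)
  coneCFF (suc a) (suc b) a~b = cone-separated (cff a b a~b)

coneCFF-restrict : ∀ {n t} (G : Graph n) {B : Fin (suc n) → Subset t} →
  IsCFF (cone G) t B → IsCFF G t (B ∘ suc)
coneCFF-restrict G cff a b a~b with cff (suc a) (suc b) a~b
... | a⊈b , b⊈a , outside-a∪b =
  a⊈b , b⊈a , λ w w≢a w≢b → outside-a∪b (suc w) (w≢a ∘ suc-injective) (w≢b ∘ suc-injective)

coneCFF-antichain : ∀ {m t} (G : Graph (suc m)) {B : Fin (suc (suc m)) → Subset (suc t)} →
  IsCFF (cone G) (suc t) B → HasAntichain (suc m) t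
coneCFF-antichain {m} {t} G {B} cff with ⊈⇒Nonempty (proj₁ (cff zero (suc zero) tt))
... | x , x∈B₀ = (λ i → removeAt (D i) x) , antichain
  where
  D : Fin (suc m) → Subset (suc t)
  D i = B (suc i) ─ B zero
  antichain : ∀ i j → i ≢ j → ¬ (removeAt (D i) x ⊆ removeAt (D j) x)
  antichain i j i≢j sub =
    proj₂ (proj₂ (cff zero (suc j) tt)) (suc i) (λ ()) (i≢j ∘ suc-injective)
      (p─r⊆q─r⇒p⊆r∪q (removeAt-reflects-⊆ (λ x∈Dᵢ → proj₂ (x∈p─q⁻ _ _ x∈Dᵢ) x∈B₀) sub))

t1<coneCFF : ∀ {m t₁ t} (G : Graph (suc m)) → IsT1 (suc m) t₁ → HasCFF (cone G) t → t₁ < t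
t1<coneCFF {t = 0}     G _              (_ , cff) = contradiction (λ ()) (proj₁ (cff zero (suc zero) tt))
t1<coneCFF {t = suc t} G (_ , t₁-least) (_ , cff) = s≤s (least-≤ t₁-least (coneCFF-antichain G cff))

theorem4p15 : (n : ℕ) → 3 ≤ n → (G : Graph n) → NoIsolated G →
    (t1n tG tG0 : ℕ) → IsT1 n t1n → IsTH G tG → IsTH (cone G) tG0 →
    ((suc t1n ⊔ tG) ≤ tG0) × (tG0 ≤ tG + 1)
theorem4p15 (suc m) _ G noIsolated t1n tG tG0 t1 ((B , cff) , tG-least) ((B₀ , cff₀) , tG0-least) =
  ⊔-lub (t1<coneCFF G t1 (B₀ , cff₀)) (least-≤ tG-least (B₀ ∘ suc , coneCFF-restrict G cff₀)) ,
  subst (tG0 ≤_) (+-comm 1 tG) (least-≤ tG0-least (coneFamily B , coneCFF noIsolated cff))
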